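{- There is an absolute constant $n_0$ such that the following holds. Let $G$ be a finite abelian group of order $n > n_0$ and let $L$ be a positive integer with $L \leq \sqrt{n}$. Then the number of subsets of $G$ which are $L$-granular (of coset type or of progression type) is at most $2^{3n/L}$.
   Context: A set is $L$-granular of coset type if it is a union of cosets of some subgroup $G_1 \leq G$ with $|G_1| \geq L$. Progression type: for each $d \in G$ of order $m \geq L$, a partition of $G$ is fixed, obtained by splitting each coset of the subgroup generated by $d$ into $\lfloor m/L\rfloor$ "grains" of the form $\{x, x+d, \dots, x+(L-1)d\}$ and one leftover set of size less than $L$ (leftover sets are not grains). A set is $L$-granular of progression type if, for some $d \in G$ of order at least $L$, it is a union of grains of the fixed partition associated with $d$. -}

module Defs where

open import Data.Nat using (ℕ; zero; suc; _≤_; _<_; _*_)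
open import Data.Nat.Properties using ()
open import Data.Fin using (Fin)
open import Data.Fin.Subset using (Subset; _∈_; _⊆_; ∣_∣)
open import Data.List using (List; length)
open import Data.List.Relation.Unary.All using (All)
open import Data.List.Relation.Unary.Unique.Propositional using (Unique)
open import Data.List.Membership.Propositional renaming (_∈_ to _∈ˡ_)
open import Data.Product using (Σ; ∃; ∃-syntax; _×_; _,_)
open import Data.Sum using (_⊎_)
open import Relation.Binary.PropositionalEquality using (_≡_)
open import Relation.Nullary using (¬_)
open import Algebra.Structures using (IsAbelianGroup)
open import Function.Bundles using (_⇔_)

-- A finite abelian group of order n, with carrier Fin n (every finite
-- abelian group of order n is isomorphic to one of this form).
record FinAbGroup (n : ℕ) : Set where
  infixl 6 _+ᴳ_
  field
    _+ᴳ_           : Fin n → Fin n → Fin n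
    0ᴳ             : Fin n
    -ᴳ_            : Fin n → Fin n
    isAbelianGroup : IsAbelianGroup _≡_ _+ᴳ_ 0ᴳ -ᴳ_

module _ {n : ℕ} (G : FinAbGroup n) where
  open FinAbGroup G

  mul : ℕ → Fin n → Fin n
  mul zero    d = 0ᴳ
  mul (suc k) d = d +ᴳ mul k d

  IsOrder : Fin n → ℕ → Set
  IsOrder d m = 1 ≤ m × mul m d ≡ 0ᴳ × (∀ k → 1 ≤ k → k < m → ¬ (mul k d ≡ 0ᴳ))

  IsSubgroup : Subset n → Set
  IsSubgroup H = 0ᴳ ∈ H × (∀ x y → x ∈ H → y ∈ H → (x +ᴳ y) ∈ H)
                        × (∀ x → x ∈ H → (-ᴳ x) ∈ H)

  CosetGranular : ℕ → Subset n → Set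
  CosetGranular L A =
    ∃[ H ] IsSubgroup H × L ≤ ∣ H ∣ ×
      ∃[ T ] (∀ y → (y ∈ A) ⇔ (∃[ t ] ∃[ h ] t ∈ T × h ∈ H × y ≡ t +ᴳ h))

  InGrain : ℕ → Fin n → Fin n → Fin n → Set
  InGrain L d x y = ∃[ i ] i < L × y ≡ x +ᴳ mul i d

  -- A fixed grain partition: for each d ∈ G a set S d of grain starting
  -- points such that, whenever d has order m ≥ L, the grains starting at
  -- points of S d are pairwise disjoint, and every coset x + ⟨d⟩ contains
  -- exactly ⌊m/L⌋ starting points (hence exactly ⌊m/L⌋ grains; the rest of
  -- the coset, of size < L, is the leftover set, which is not a grain).
  record GrainPartition (L : ℕ) : Set where
    field
      S        : Fin n → Subset n
      disjoint : ∀ d m → IsOrder d m → L ≤ m →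
                 ∀ s s' i j → s ∈ S d → s' ∈ S d → i < L → j < L →
                 s +ᴳ mul i d ≡ s' +ᴳ mul j d → s ≡ s'
      perCoset : ∀ d m → IsOrder d m → L ≤ m → ∀ x →
                 Σ (List (Fin n)) λ ss →
                   length ss * L ≤ m × m < suc (length ss) * L ×  -- length ss = ⌊m/L⌋
                    Unique ss ×
                   (∀ s → (s ∈ˡ ss) ⇔ (s ∈ S d × ∃[ k ] s ≡ x +ᴳ mul k d))

  ProgressionGranular : (L : ℕ) → GrainPartition L → Subset n → Set
  ProgressionGranular L P A =
    ∃[ d ] (∃[ m ] IsOrder d m × L ≤ m) ×
      ∃[ T ] T ⊆ GrainPartition.S P d ×
        (∀ y → (y ∈ A) ⇔ (∃[ x ] x ∈ T × InGrain L d x y))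

  Granular : (L : ℕ) → GrainPartition L → Subset n → Set
  Granular L P A = CosetGranular L A ⊎ ProgressionGranular L P A

module Submission where

-- Each granular set is a union of blocks from one of few block families. For
-- progression type the family consists of the grains of the fixed partition for
-- one d ∈ G (n choices). For coset type it consists of the cosets of a subgroup
-- K ≤ H with |K| ≥ L generated by at most r = ⌊log₂ L⌋ + 1 elements, which exist
-- because adding a generator outside the current span doubles it ((n + 1)ʳ
-- choices). The blocks of a family are pairwise disjoint with at least L elements,
-- so there are at most n/L of them and at most 2^(n/L) unions. Hence there are at
-- most (n + 1)^(r+1) · 2^(n/L) granular sets, and the L-th power of this is at
-- most 2^(3n) since (n + 1)^((r+1)L) ≤ 2^(2n) once L ≤ √n and n > 2¹⁶.

open import Defs
open import Data.Nat using (ℕ; _≤_; _<_; _*_; _^_)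
open import Data.Fin.Subset using (Subset)
open import Data.List using (List; length)
open import Data.List.Relation.Unary.All using (All)
open import Data.List.Relation.Unary.Unique.Propositional using (Unique)
open import Data.Product using (∃-syntax)

open import Level using (0ℓ)
open import Algebra.Bundles using (AbelianGroup)
import Algebra.Properties.AbelianGroup as AbelianGroupProperties
import Algebra.Properties.CommutativeSemigroup as CommutativeSemigroupProperties
open import Data.Nat
  using (zero; suc; _+_; _∸_; _/_; _%_; _<?_; _≤′_; ≤′-refl; ≤′-step; z≤n; s≤s; NonZero)
open import Data.Nat.Properties
open import Data.Nat.DivMod using (m≡m%n+[m/n]*n; m%n<n; m*n/n≡m; m/n*n≤m; /-monoˡ-≤)
open import Data.Nat.Tactic.RingSolver using (solve-∀)
open import Data.Bool.Properties using () renaming (_≟_ to _≟ᵇ_)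
open import Data.Fin using (Fin; toℕ) renaming (zero to fzero; suc to fsuc)
import Data.Fin.Properties as Fin
open import Data.Fin.Subset using (_∈_; _∉_; _⊆_; ∣_∣; inside; outside; ⊤; ⊥; _∪_; ⋃; ⁅_⁆)
open import Data.Fin.Subset.Properties
  using (_∈?_; _⊆?_; x∈p∪q⁺; x∈p∪q⁻; ∉⊥; x∈⁅x⁆; x∈⁅y⁆⇒x≡y; ⊆-antisym; ∈⊤; ∣⊤∣≡n;
         p⊆q⇒∣p∣≤∣q∣; x∈p⇒∣p-x∣<∣p∣)
open import Data.Vec using ([]; _∷_; here; there)
open import Data.Vec.Properties using (≡-dec)
open import Data.List
  using ([]; _∷_; [_]; map; _++_; concat; filter; allFin; upTo; applyUpTo; deduplicate)
open import Data.List.Properties using (length-++; length-map; length-applyUpTo; length-tabulate)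
open import Data.List.Relation.Unary.All as All using ([]; _∷_)
open import Data.List.Relation.Unary.AllPairs using ([]; _∷_)
open import Data.List.Relation.Unary.Any using (here; there)
import Data.List.Relation.Unary.Unique.Propositional.Properties as Unique
import Data.List.Relation.Unary.Unique.DecPropositional.Properties as Deduplicate
open import Data.List.Relation.Binary.Disjoint.Propositional using (Disjoint)
open import Data.List.Relation.Binary.Subset.Propositional using () renaming (_⊆_ to _⊆ˡ_)
open import Data.List.Membership.Propositional using () renaming (_∈_ to _∈ˡ_)
open import Data.List.Membership.Propositional.Properties
open import Data.Product using (_×_; _,_; proj₂)
open import Data.Sum using (_⊎_; inj₁; inj₂)
open import Data.Empty using (⊥-elim)
open import Function using (_∘_)
open import Function.Bundles using (Equivalence; _⇔_)
open import Relation.Nullary using (yes; no)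
open import Relation.Nullary.Decidable using (_×-dec_; ¬?)
open import Relation.Binary.Definitions using (DecidableEquality; tri<; tri≈; tri>)
open import Relation.Binary.PropositionalEquality hiding ([_])

private
  variable
    A : Set
    n L : ℕ

Unique⇒length≤ : {xs ys : List A} → Unique xs → xs ⊆ˡ ys → length xs ≤ length ys
Unique⇒length≤ {xs = []} _ _ = z≤n
Unique⇒length≤ {xs = x ∷ xs} (x∉xs ∷ xs!) xs⊆ys
  with us , vs , refl ← ∈-∃++ (xs⊆ys (here refl)) = begin
    suc (length xs)             ≤⟨ s≤s (Unique⇒length≤ xs! xs⊆us++vs) ⟩
    suc (length (us ++ vs))     ≡⟨ cong suc (length-++ us) ⟩
    suc (length us + length vs) ≡⟨ +-suc (length us) (length vs) ⟨
    length us + suc (length vs) ≡⟨ length-++ us ⟨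
    length (us ++ x ∷ vs)       ∎
  where
  open ≤-Reasoning
  xs⊆us++vs : xs ⊆ˡ us ++ vs
  xs⊆us++vs {z} z∈xs with ∈-++⁻ us (xs⊆ys (there z∈xs))
  ... | inj₁ z∈us         = ∈-++⁺ˡ z∈us
  ... | inj₂ (here refl)  = ⊥-elim (All.lookup x∉xs z∈xs refl)
  ... | inj₂ (there z∈vs) = ∈-++⁺ʳ us z∈vs

length-concat-map≤ : ∀ {B : Set} (f : A → List B) {c} (xs : List A) →
                     (∀ x → length (f x) ≤ c) → length (concat (map f xs)) ≤ length xs * c
length-concat-map≤ f []       _  = z≤n
length-concat-map≤ f {c} (x ∷ xs) fx≤c = begin
  length (f x ++ concat (map f xs))          ≡⟨ length-++ (f x) ⟩
  length (f x) + length (concat (map f xs))  ≤⟨ +-mono-≤ (fx≤c x) (length-concat-map≤ f xs fx≤c) ⟩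
  c + length xs * c                          ∎
  where open ≤-Reasoning

listsUpTo : (n k : ℕ) → List (List (Fin n))
listsUpTo n zero    = [ [] ]
listsUpTo n (suc k) = [] ∷ concat (map (λ x → map (x ∷_) (listsUpTo n k)) (allFin n))

length-listsUpTo : ∀ n k → length (listsUpTo n k) ≤ suc n ^ k
length-listsUpTo n zero    = ≤-refl
length-listsUpTo n (suc k) = begin
  suc (length (concat (map extensions (allFin n))))
    ≤⟨ s≤s (length-concat-map≤ extensions (allFin n) |extensions|≤) ⟩
  suc (length (allFin n) * suc n ^ k)  ≡⟨ cong (λ l → suc (l * suc n ^ k)) (length-tabulate {n = n} (λ i → i)) ⟩
  suc (n * suc n ^ k)                  ≤⟨ +-monoˡ-≤ (n * suc n ^ k) (m^n>0 (suc n) k) ⟩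
  suc n ^ k + n * suc n ^ k            ∎
  where
  open ≤-Reasoning
  extensions : Fin n → List (List (Fin n))
  extensions x = map (x ∷_) (listsUpTo n k)
  |extensions|≤ : ∀ x → length (extensions x) ≤ suc n ^ k
  |extensions|≤ x = ≤-trans (≤-reflexive (length-map (x ∷_) (listsUpTo n k))) (length-listsUpTo n k)

∈-listsUpTo : ∀ {n k} (D : List (Fin n)) → length D ≤ k → D ∈ˡ listsUpTo n k
∈-listsUpTo {k = zero}  []      _           = here refl
∈-listsUpTo {k = suc k} []      _           = here refl
∈-listsUpTo {n} {suc k} (x ∷ D) (s≤s |D|≤k) =
  there (∈-concat⁺′ (∈-map⁺ (x ∷_) (∈-listsUpTo D |D|≤k))
                    (∈-map⁺ (λ x → map (x ∷_) (listsUpTo n k)) (∈-allFin x)))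

-- Finite subsets as lists

_≟ˢ_ : ∀ {n} → DecidableEquality (Subset n)
_≟ˢ_ = ≡-dec _≟ᵇ_

elements : Subset n → List (Fin n)
elements []            = []
elements (inside ∷ p)  = fzero ∷ map fsuc (elements p)
elements (outside ∷ p) = map fsuc (elements p)

length-elements : (p : Subset n) → length (elements p) ≡ ∣ p ∣
length-elements []            = refl
length-elements (inside ∷ p)  = cong suc (trans (length-map fsuc (elements p)) (length-elements p))
length-elements (outside ∷ p) = trans (length-map fsuc (elements p)) (length-elements p)

elements-unique : (p : Subset n) → Unique (elements p)
elements-unique []            = []
elements-unique (inside ∷ p)  = All.tabulate 0∉ ∷ Unique.map⁺ Fin.suc-injective (elements-unique p)
  where
  0∉ : ∀ {y} → y ∈ˡ map fsuc (elements p) → fzero ≢ y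
  0∉ y∈ refl with _ , _ , () ← ∈-map⁻ fsuc y∈
elements-unique (outside ∷ p) = Unique.map⁺ Fin.suc-injective (elements-unique p)

∈-elements⁺ : {p : Subset n} {x : Fin n} → x ∈ p → x ∈ˡ elements p
∈-elements⁺ {p = inside ∷ p}  here        = here refl
∈-elements⁺ {p = inside ∷ p}  (there x∈p) = there (∈-map⁺ fsuc (∈-elements⁺ x∈p))
∈-elements⁺ {p = outside ∷ p} (there x∈p) = ∈-map⁺ fsuc (∈-elements⁺ x∈p)

∈-elements⁻ : {p : Subset n} {x : Fin n} → x ∈ˡ elements p → x ∈ p
∈-elements⁻ {p = inside ∷ p} (here refl) = here
∈-elements⁻ {p = inside ∷ p} (there x∈)
  with _ , y∈ , refl ← ∈-map⁻ fsuc x∈ = there (∈-elements⁻ y∈)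
∈-elements⁻ {p = outside ∷ p} x∈
  with _ , y∈ , refl ← ∈-map⁻ fsuc x∈ = there (∈-elements⁻ y∈)

Unique⇒length≤∣p∣ : {xs : List (Fin n)} {p : Subset n} →
                   Unique xs → (∀ {x} → x ∈ˡ xs → x ∈ p) → length xs ≤ ∣ p ∣
Unique⇒length≤∣p∣ {p = p} xs! xs⊆p =
  ≤-trans (Unique⇒length≤ xs! (∈-elements⁺ ∘ xs⊆p)) (≤-reflexive (length-elements p))

∈-⋃⁺ : {bs : List (Subset n)} {b : Subset n} {x : Fin n} → b ∈ˡ bs → x ∈ b → x ∈ ⋃ bs
∈-⋃⁺ (here refl) x∈b = x∈p∪q⁺ (inj₁ x∈b)
∈-⋃⁺ (there b∈)  x∈b = x∈p∪q⁺ (inj₂ (∈-⋃⁺ b∈ x∈b))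

∈-⋃⁻ : (bs : List (Subset n)) {x : Fin n} → x ∈ ⋃ bs → ∃[ b ] b ∈ˡ bs × x ∈ b
∈-⋃⁻ []       x∈ = ⊥-elim (∉⊥ x∈)
∈-⋃⁻ (b ∷ bs) x∈ with x∈p∪q⁻ b (⋃ bs) x∈
... | inj₁ x∈b = b , here refl , x∈b
... | inj₂ x∈⋃ with c , c∈ , x∈c ← ∈-⋃⁻ bs x∈⋃ = c , there c∈ , x∈c

fromList : List (Fin n) → Subset n
fromList xs = ⋃ (map ⁅_⁆ xs)

∈-fromList⁺ : {xs : List (Fin n)} {x : Fin n} → x ∈ˡ xs → x ∈ fromList xs
∈-fromList⁺ {x = x} x∈xs = ∈-⋃⁺ (∈-map⁺ ⁅_⁆ x∈xs) (x∈⁅x⁆ x)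

∈-fromList⁻ : (xs : List (Fin n)) {x : Fin n} → x ∈ fromList xs → x ∈ˡ xs
∈-fromList⁻ xs x∈
  with _ , s∈ , x∈s ← ∈-⋃⁻ (map ⁅_⁆ xs) x∈
  with y , y∈ , refl ← ∈-map⁻ ⁅_⁆ s∈ = subst (_∈ˡ xs) (sym (x∈⁅y⁆⇒x≡y y x∈s)) y∈

Unique⇒length≤∣fromList∣ : {xs : List (Fin n)} → Unique xs → length xs ≤ ∣ fromList xs ∣
Unique⇒length≤∣fromList∣ xs! = Unique⇒length≤∣p∣ xs! ∈-fromList⁺

-- Disjoint blocks and their unions

MeetOnlyIfEqual : List (Subset n) → Set
MeetOnlyIfEqual bs = ∀ {b c x} → b ∈ˡ bs → c ∈ˡ bs → x ∈ b → x ∈ c → b ≡ c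

concat-elements-unique : {bs : List (Subset n)} →
                         Unique bs → MeetOnlyIfEqual bs → Unique (concat (map elements bs))
concat-elements-unique []                 _    = []
concat-elements-unique {bs = b ∷ bs} (b∉bs ∷ bs!) meet =
  Unique.++⁺ (elements-unique b) (concat-elements-unique bs! (λ b∈ c∈ → meet (there b∈) (there c∈)))
             b∩rest≡∅
  where
  b∩rest≡∅ : Disjoint (elements b) (concat (map elements bs))
  b∩rest≡∅ (x∈b , x∈rest)
    with _ , x∈xs , xs∈ ← ∈-concat⁻′ (map elements bs) x∈rest
    with c , c∈bs , refl ← ∈-map⁻ elements xs∈
    = All.lookup b∉bs c∈bs (meet (here refl) (there c∈bs) (∈-elements⁻ x∈b) (∈-elements⁻ x∈xs))

disjointBlocks-count : {bs : List (Subset n)} → Unique bs → MeetOnlyIfEqual bs →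
                       All (λ b → L ≤ ∣ b ∣) bs → length bs * L ≤ n
disjointBlocks-count {n} {L} {bs} bs! meet large = begin
  length bs * L                        ≤⟨ ≤-length-concat large ⟩
  length (concat (map elements bs))    ≤⟨ Unique⇒length≤∣p∣ (concat-elements-unique bs! meet) (λ _ → ∈⊤) ⟩
  ∣ ⊤ {n} ∣                            ≡⟨ ∣⊤∣≡n n ⟩
  n                                    ∎
  where
  open ≤-Reasoning
  ≤-length-concat : {cs : List (Subset n)} → All (λ b → L ≤ ∣ b ∣) cs →
                    length cs * L ≤ length (concat (map elements cs))
  ≤-length-concat []                      = z≤n
  ≤-length-concat {c ∷ cs} (L≤∣c∣ ∷ large) = begin
    L + length cs * L                                ≤⟨ +-mono-≤ L≤∣c∣ (≤-length-concat large) ⟩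
    ∣ c ∣ + length (concat (map elements cs))        ≡⟨ cong (_+ _) (length-elements c) ⟨
    length (elements c) + length (concat (map elements cs)) ≡⟨ length-++ (elements c) ⟨
    length (concat (map elements (c ∷ cs)))          ∎

unions : List (Subset n) → List (Subset n)
unions []       = [ ⊥ ]
unions (b ∷ bs) = unions bs ++ map (b ∪_) (unions bs)

length-unions : (bs : List (Subset n)) → length (unions bs) ≡ 2 ^ length bs
length-unions []       = refl
length-unions (b ∷ bs) = begin
  length (unions bs ++ map (b ∪_) (unions bs))          ≡⟨ length-++ (unions bs) ⟩
  length (unions bs) + length (map (b ∪_) (unions bs))  ≡⟨ cong (length (unions bs) +_) (length-map (b ∪_) (unions bs)) ⟩
  length (unions bs) + length (unions bs)               ≡⟨ cong (length (unions bs) +_) (+-identityʳ _) ⟨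
  2 * length (unions bs)                                ≡⟨ cong (2 *_) (length-unions bs) ⟩
  2 ^ length (b ∷ bs)                                   ∎
  where open ≡-Reasoning

⋃-filter∈unions : (A : Subset n) (bs : List (Subset n)) → ⋃ (filter (_⊆? A) bs) ∈ˡ unions bs
⋃-filter∈unions A []       = here refl
⋃-filter∈unions A (b ∷ bs) with b ⊆? A
... | yes _ = ∈-++⁺ʳ (unions bs) (∈-map⁺ (b ∪_) (⋃-filter∈unions A bs))
... | no  _ = ∈-++⁺ˡ (⋃-filter∈unions A bs)

Covers : List (Subset n) → Subset n → Set
Covers bs A = ∀ {y} → y ∈ A → ∃[ b ] b ∈ˡ bs × b ⊆ A × y ∈ b

∈-unions : {bs : List (Subset n)} {A : Subset n} → Covers bs A → A ∈ˡ unions bs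
∈-unions {bs = bs} {A} cover = subst (_∈ˡ unions bs) (⊆-antisym ⋃⊆A A⊆⋃) (⋃-filter∈unions A bs)
  where
  ⋃⊆A : ⋃ (filter (_⊆? A) bs) ⊆ A
  ⋃⊆A x∈ with _ , b∈ , x∈b ← ∈-⋃⁻ (filter (_⊆? A) bs) x∈ = proj₂ (∈-filter⁻ (_⊆? A) {xs = bs} b∈) x∈b
  A⊆⋃ : A ⊆ ⋃ (filter (_⊆? A) bs)
  A⊆⋃ y∈ with b , b∈ , b⊆A , y∈b ← cover y∈ = ∈-⋃⁺ (∈-filter⁺ (_⊆? A) b∈ b⊆A) y∈b

-- Truncated to [] when there are too many blocks, so that its length is bounded unconditionally.
unionsIfFew : ℕ → List (Subset n) → List (Subset n)
unionsIfFew {n} L bs with length bs * L ≤? n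
... | yes _ = unions bs
... | no  _ = []

length-unionsIfFew : (L : ℕ) .{{_ : NonZero L}} (bs : List (Subset n)) →
                     length (unionsIfFew L bs) ≤ 2 ^ (n / L)
length-unionsIfFew {n} L bs with length bs * L ≤? n
... | no  _   = z≤n
... | yes few = begin
  length (unions bs)  ≡⟨ length-unions bs ⟩
  2 ^ length bs       ≤⟨ ^-monoʳ-≤ 2 (subst (_≤ n / L) (m*n/n≡m (length bs) L) (/-monoˡ-≤ L few)) ⟩
  2 ^ (n / L)         ∎
  where open ≤-Reasoning

∈-unionsIfFew : {bs : List (Subset n)} {A : Subset n} →
                length bs * L ≤ n → Covers bs A → A ∈ˡ unionsIfFew L bs
∈-unionsIfFew {n} {L} {bs} few cover with length bs * L ≤? n
... | yes _    = ∈-unions cover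
... | no  many = ⊥-elim (many few)

-- Arithmetic

log₂-bracket : ∀ m → ∃[ k ] 2 ^ k ≤ suc m × suc m < 2 ^ suc k
log₂-bracket zero = 0 , ≤-refl , s≤s (s≤s z≤n)
log₂-bracket (suc m) with k , 2^k≤1+m , 1+m<2^[1+k] ← log₂-bracket m
  with suc (suc m) <? 2 ^ suc k
... | yes 2+m<2^[1+k] = k , m≤n⇒m≤1+n 2^k≤1+m , 2+m<2^[1+k]
... | no  2+m≮2^[1+k] = suc k , ≮⇒≥ 2+m≮2^[1+k] ,
                        ≤-<-trans 1+m<2^[1+k] (^-monoʳ-< 2 (s≤s (s≤s z≤n)) (n<1+n (suc k)))

^-distribʳ-* : ∀ m n o → (m * n) ^ o ≡ m ^ o * n ^ o
^-distribʳ-* m n zero    = refl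
^-distribʳ-* m n (suc o) =
  trans (cong ((m * n) *_) (^-distribʳ-* m n o)) ([m*n]*[o*p]≡[m*o]*[n*p] m n (m ^ o) (n ^ o))

2^m<2^n⇒m<n : ∀ {a b} → 2 ^ a < 2 ^ b → a < b
2^m<2^n⇒m<n 2^a<2^b = ≰⇒> (λ b≤a → <⇒≱ 2^a<2^b (^-monoʳ-≤ 2 b≤a))

m*m≤n*n⇒m≤n : ∀ {a b} → a * a ≤ b * b → a ≤ b
m*m≤n*n⇒m≤n a²≤b² = ≮⇒≥ (λ b<a → <⇒≱ (*-mono-< b<a b<a) a²≤b²)

-- x⁴ ≤ 2ˣ passes from x to 1 + x as long as (1 + 1/x)⁴ ≤ 2, which holds once x ≥ c with (1 + c)⁴ ≤ 2c⁴.
^4≤2^-step : ∀ {c x} .{{_ : NonZero c}} → c ≤ x → suc c ^ 4 ≤ 2 * c ^ 4 →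
             x ^ 4 ≤ 2 ^ x → suc x ^ 4 ≤ 2 ^ suc x
^4≤2^-step {c} {x} c≤x [1+c]⁴≤2c⁴ x⁴≤2ˣ = *-cancelˡ-≤ (c ^ 4) {{m^n≢0 c 4}} (begin
  c ^ 4 * suc x ^ 4      ≡⟨ ^-distribʳ-* c (suc x) 4 ⟨
  (c * suc x) ^ 4        ≤⟨ ^-monoˡ-≤ 4 c[1+x]≤[1+c]x ⟩
  (suc c * x) ^ 4        ≡⟨ ^-distribʳ-* (suc c) x 4 ⟩
  suc c ^ 4 * x ^ 4      ≤⟨ *-mono-≤ [1+c]⁴≤2c⁴ x⁴≤2ˣ ⟩
  2 * c ^ 4 * 2 ^ x      ≡⟨ cong (_* 2 ^ x) (*-comm 2 (c ^ 4)) ⟩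
  c ^ 4 * 2 * 2 ^ x      ≡⟨ *-assoc (c ^ 4) 2 (2 ^ x) ⟩
  c ^ 4 * 2 ^ suc x      ∎)
  where
  open ≤-Reasoning
  c[1+x]≤[1+c]x : c * suc x ≤ suc c * x
  c[1+x]≤[1+c]x = begin
    c * suc x  ≡⟨ *-suc c x ⟩
    c + c * x  ≤⟨ +-monoˡ-≤ (c * x) c≤x ⟩
    suc c * x  ∎

^4≤2^ : ∀ {a} → 16 ≤ a → a ^ 4 ≤ 2 ^ a
^4≤2^ 16≤a = go (≤⇒≤′ 16≤a)
  where
  go : ∀ {a} → 16 ≤′ a → a ^ 4 ≤ 2 ^ a
  go ≤′-refl           = ≤ᵇ⇒≤ (16 ^ 4) (2 ^ 16) _
  go (≤′-step 16≤′a) = ^4≤2^-step (≤′⇒≤ 16≤′a) (≤ᵇ⇒≤ (17 ^ 4) (2 * 16 ^ 4) _) (go 16≤′a)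

-- With a = ⌊log₂ n⌋ + 1: 1 + r ≤ a and a⁴ ≤ 2ᵃ ≤ 4n, so (a (1 + r) L)² ≤ a⁴ L² ≤ (2n)².
polylog-bound : ∀ {n L r} → 2 ^ 16 < n → L * L ≤ n → 2 ^ r ≤ 2 * L →
                suc n ^ (suc r * L) ≤ 2 ^ (2 * n)
polylog-bound {n} {L} {r} 2^16<n L²≤n 2^r≤2L
  with b , 2^b≤1+n , 1+n<2^[1+b] ← log₂-bracket n = begin
    suc n ^ (suc r * L)      ≤⟨ ^-monoˡ-≤ (suc r * L) (<⇒≤ 1+n<2^[1+b]) ⟩
    (2 ^ a) ^ (suc r * L)    ≡⟨ ^-*-assoc 2 a (suc r * L) ⟩
    2 ^ (a * (suc r * L))    ≤⟨ ^-monoʳ-≤ 2 (m*m≤n*n⇒m≤n {a * (suc r * L)} {2 * n} exponent²≤) ⟩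
    2 ^ (2 * n)              ∎
  where
  open ≤-Reasoning
  a = suc b
  n<2^a : n < 2 ^ a
  n<2^a = <-trans (n<1+n n) 1+n<2^[1+b]
  16<a : 16 < a
  16<a = 2^m<2^n⇒m<n {16} {a} (<-trans 2^16<n n<2^a)
  2^a≤4n : 2 ^ a ≤ 4 * n
  2^a≤4n = begin
    2 * 2 ^ b      ≤⟨ *-monoʳ-≤ 2 2^b≤1+n ⟩
    2 * suc n      ≡⟨ *-suc 2 n ⟩
    2 + 2 * n      ≤⟨ +-monoˡ-≤ (2 * n) (*-monoʳ-≤ 2 (≤-trans (s≤s z≤n) 2^16<n)) ⟩
    2 * n + 2 * n  ≡⟨ *-distribʳ-+ n 2 2 ⟨
    4 * n          ∎
  r+r<2+a : r + r < 2 + a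
  r+r<2+a = 2^m<2^n⇒m<n {r + r} {2 + a} (begin-strict
    2 ^ (r + r)        ≡⟨ ^-distribˡ-+-* 2 r r ⟩
    2 ^ r * 2 ^ r      ≤⟨ *-mono-≤ 2^r≤2L 2^r≤2L ⟩
    (2 * L) * (2 * L)  ≡⟨ [m*n]*[o*p]≡[m*o]*[n*p] 2 L 2 L ⟩
    4 * (L * L)        ≤⟨ *-monoʳ-≤ 4 L²≤n ⟩
    4 * n              <⟨ *-monoʳ-< 4 n<2^a ⟩
    4 * 2 ^ a          ≡⟨ *-assoc 2 2 (2 ^ a) ⟩
    2 ^ (2 + a)        ∎)
  1+r≤a : suc r ≤ a
  1+r≤a = ≰⇒> (λ a≤r → <⇒≱ 16<a (≤-trans (+-cancelʳ-≤ a a 1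
    (≤-trans (+-mono-≤ a≤r a≤r) (≤-pred r+r<2+a))) (s≤s z≤n)))
  exponent²≤ : (a * (suc r * L)) * (a * (suc r * L)) ≤ (2 * n) * (2 * n)
  exponent²≤ = begin
    (a * (suc r * L)) * (a * (suc r * L))  ≤⟨ *-mono-≤ a[1+r]L≤a²L a[1+r]L≤a²L ⟩
    (a * (a * L)) * (a * (a * L))          ≡⟨ regroup a L ⟩
    a ^ 4 * (L * L)                        ≤⟨ *-mono-≤ (^4≤2^ (<⇒≤ 16<a)) L²≤n ⟩
    2 ^ a * n                              ≤⟨ *-monoˡ-≤ n 2^a≤4n ⟩
    4 * n * n                              ≡⟨ double² n ⟩
    (2 * n) * (2 * n)                      ∎
    where
    a[1+r]L≤a²L : a * (suc r * L) ≤ a * (a * L)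
    a[1+r]L≤a²L = *-monoʳ-≤ a (*-monoˡ-≤ L 1+r≤a)
    regroup : ∀ a L → (a * (a * L)) * (a * (a * L)) ≡ a * (a * (a * (a * 1))) * (L * L)
    regroup = solve-∀
    double² : ∀ n → 4 * n * n ≡ (2 * n) * (2 * n)
    double² = solve-∀

candidate-count-bound : ∀ {n L r} .{{_ : NonZero L}} → 2 ^ 16 < n → L * L ≤ n → 2 ^ r ≤ 2 * L →
                        (suc n ^ suc r * 2 ^ (n / L)) ^ L ≤ 2 ^ (3 * n)
candidate-count-bound {n} {L} {r} 2^16<n L²≤n 2^r≤2L = begin
  (suc n ^ suc r * 2 ^ (n / L)) ^ L        ≡⟨ ^-distribʳ-* (suc n ^ suc r) (2 ^ (n / L)) L ⟩
  (suc n ^ suc r) ^ L * (2 ^ (n / L)) ^ L  ≡⟨ cong₂ _*_ (^-*-assoc (suc n) (suc r) L) (^-*-assoc 2 (n / L) L) ⟩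
  suc n ^ (suc r * L) * 2 ^ (n / L * L)    ≤⟨ *-mono-≤ (polylog-bound {n} {L} {r} 2^16<n L²≤n 2^r≤2L) (^-monoʳ-≤ 2 (m/n*n≤m n L)) ⟩
  2 ^ (2 * n) * 2 ^ n                      ≡⟨ ^-distribˡ-+-* 2 (2 * n) n ⟨
  2 ^ (2 * n + n)                          ≡⟨ cong (2 ^_) (+-comm (2 * n) n) ⟩
  2 ^ (3 * n)                              ∎
  where open ≤-Reasoning

-- Multiples, subgroups and cosets in a finite abelian group

module _ {n : ℕ} (G : FinAbGroup n) where
  open FinAbGroup G

  private
    abelianGroup : AbelianGroup 0ℓ 0ℓ
    abelianGroup = record
      { Carrier = Fin n ; _≈_ = _≡_ ; _∙_ = _+ᴳ_ ; ε = 0ᴳ ; _⁻¹ = -ᴳ_ ; isAbelianGroup = isAbelianGroup }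

  open AbelianGroup abelianGroup using (assoc; identityˡ; identityʳ; inverseʳ; commutativeSemigroup)
  open AbelianGroupProperties abelianGroup using (∙-cancelˡ; \\-leftDividesˡ; //-rightDividesʳ)
  open CommutativeSemigroupProperties commutativeSemigroup using (interchange)

  0<n : 0 < n
  0<n = ≤-<-trans z≤n (Fin.toℕ<n 0ᴳ)

  mul-+ : ∀ a b d → mul G (a + b) d ≡ mul G a d +ᴳ mul G b d
  mul-+ zero    b d = sym (identityˡ _)
  mul-+ (suc a) b d = trans (cong (d +ᴳ_) (mul-+ a b d)) (sym (assoc d _ _))

  mul-*-period : ∀ {m d} → mul G m d ≡ 0ᴳ → ∀ q → mul G (q * m) d ≡ 0ᴳ
  mul-*-period         md≡0 zero    = refl
  mul-*-period {m} {d} md≡0 (suc q) = begin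
    mul G (m + q * m) d           ≡⟨ mul-+ m (q * m) d ⟩
    mul G m d +ᴳ mul G (q * m) d  ≡⟨ cong₂ _+ᴳ_ md≡0 (mul-*-period md≡0 q) ⟩
    0ᴳ +ᴳ 0ᴳ                      ≡⟨ identityˡ 0ᴳ ⟩
    0ᴳ                            ∎
    where open ≡-Reasoning

  mul-∸ : ∀ {a b} d → a ≤ b → mul G a d ≡ mul G b d → mul G (b ∸ a) d ≡ 0ᴳ
  mul-∸ {a} {b} d a≤b ad≡bd = ∙-cancelˡ (mul G a d) _ _ (begin
    mul G a d +ᴳ mul G (b ∸ a) d  ≡⟨ mul-+ a (b ∸ a) d ⟨
    mul G (a + (b ∸ a)) d         ≡⟨ cong (λ k → mul G k d) (m+[n∸m]≡n a≤b) ⟩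
    mul G b d                     ≡⟨ ad≡bd ⟨
    mul G a d                     ≡⟨ identityʳ _ ⟨
    mul G a d +ᴳ 0ᴳ               ∎)
    where open ≡-Reasoning

  ∃-period : ∀ d → ∃[ m ] 1 ≤ m × m ≤ n × mul G m d ≡ 0ᴳ
  ∃-period d with i , j , i<j , id≡jd ← Fin.pigeonhole (n<1+n n) (λ i → mul G (toℕ i) d) =
    toℕ j ∸ toℕ i , m<n⇒0<n∸m i<j ,
    ≤-trans (m∸n≤m (toℕ j) (toℕ i)) (≤-pred (Fin.toℕ<n j)) ,
    mul-∸ d (<⇒≤ i<j) id≡jd

  mul-mod : ∀ c d → ∃[ c′ ] c′ < n × mul G c d ≡ mul G c′ d
  mul-mod c d with suc m , _ , m≤n , md≡0 ← ∃-period d = c % suc m , <-≤-trans (m%n<n c (suc m)) m≤n , (begin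
    mul G c d                                          ≡⟨ cong (λ k → mul G k d) (m≡m%n+[m/n]*n c (suc m)) ⟩
    mul G (c % suc m + c / suc m * suc m) d            ≡⟨ mul-+ (c % suc m) _ d ⟩
    mul G (c % suc m) d +ᴳ mul G (c / suc m * suc m) d ≡⟨ cong (mul G (c % suc m) d +ᴳ_) (mul-*-period md≡0 (c / suc m)) ⟩
    mul G (c % suc m) d +ᴳ 0ᴳ                          ≡⟨ identityʳ _ ⟩
    mul G (c % suc m) d                                ∎)
    where open ≡-Reasoning

  -ᴳ-as-mul : ∀ d → ∃[ k ] mul G k d ≡ -ᴳ d
  -ᴳ-as-mul d with suc m , _ , _ , md≡0 ← ∃-period d =
    m , ∙-cancelˡ d _ _ (trans md≡0 (sym (inverseʳ d)))

  mul-injective : ∀ {d m i j} → IsOrder G d m → i < m → j < m → mul G i d ≡ mul G j d → i ≡ j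
  mul-injective {d} {m} {i} {j} (_ , _ , minimal) i<m j<m id≡jd with <-cmp i j
  ... | tri≈ _ i≡j _ = i≡j
  ... | tri< i<j _ _ = ⊥-elim (minimal (j ∸ i) (m<n⇒0<n∸m i<j) (≤-<-trans (m∸n≤m j i) j<m) (mul-∸ d (<⇒≤ i<j) id≡jd))
  ... | tri> _ _ j<i = ⊥-elim (minimal (i ∸ j) (m<n⇒0<n∸m j<i) (≤-<-trans (m∸n≤m i j) i<m) (mul-∸ d (<⇒≤ j<i) (sym id≡jd)))

  IsSubmonoid : Subset n → Set
  IsSubmonoid H = 0ᴳ ∈ H × (∀ x y → x ∈ H → y ∈ H → (x +ᴳ y) ∈ H)

  mul-closed : ∀ {H x} → IsSubmonoid H → ∀ k → x ∈ H → mul G k x ∈ H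
  mul-closed (0∈H , _)                zero    x∈H = 0∈H
  mul-closed monoid@(_ , +-closed) (suc k) x∈H = +-closed _ _ x∈H (mul-closed monoid k x∈H)

  submonoid⇒subgroup : ∀ {H} → IsSubmonoid H → IsSubgroup G H
  submonoid⇒subgroup {H} monoid@(0∈H , +-closed) = 0∈H , +-closed , -closed
    where
    -closed : ∀ x → x ∈ H → (-ᴳ x) ∈ H
    -closed x x∈H with k , kx≡-x ← -ᴳ-as-mul x = subst (_∈ H) kx≡-x (mul-closed monoid k x∈H)

  -- Opaque so that D can be recovered from a membership proof in span D.
  opaque
    spanList : List (Fin n) → List (Fin n)
    spanList []      = [ 0ᴳ ]
    spanList (d ∷ D) = concat (map (λ c → map (mul G c d +ᴳ_) (spanList D)) (upTo n))

    span : List (Fin n) → Subset n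
    span D = fromList (spanList D)

    0∈span[] : 0ᴳ ∈ span []
    0∈span[] = ∈-fromList⁺ {xs = spanList []} (here refl)

    ∈-span[]⁻ : ∀ {x} → x ∈ span [] → x ≡ 0ᴳ
    ∈-span[]⁻ x∈ with ∈-fromList⁻ (spanList []) x∈
    ... | here x≡0 = x≡0
    ... | there ()

    ∈-span∷⁺ : ∀ {d D c s} → c < n → s ∈ span D → (mul G c d +ᴳ s) ∈ span (d ∷ D)
    ∈-span∷⁺ {d} {D} {c} c<n s∈ = ∈-fromList⁺ (∈-concat⁺′
      (∈-map⁺ (mul G c d +ᴳ_) (∈-fromList⁻ (spanList D) s∈))
      (∈-map⁺ (λ c → map (mul G c d +ᴳ_) (spanList D)) (∈-upTo⁺ c<n)))

    ∈-span∷⁻ : ∀ {d D y} → y ∈ span (d ∷ D) → ∃[ c ] ∃[ s ] s ∈ span D × y ≡ mul G c d +ᴳ s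
    ∈-span∷⁻ {d} {D} y∈
      with _ , y∈xs , xs∈ ← ∈-concat⁻′ (map (λ c → map (mul G c d +ᴳ_) (spanList D)) (upTo n))
                                        (∈-fromList⁻ (spanList (d ∷ D)) y∈)
      with c , _ , refl ← ∈-map⁻ (λ c → map (mul G c d +ᴳ_) (spanList D)) xs∈
      with s , s∈ , refl ← ∈-map⁻ (mul G c d +ᴳ_) y∈xs
      = c , s , ∈-fromList⁺ s∈ , refl

  0∈span : ∀ D → 0ᴳ ∈ span D
  0∈span []      = 0∈span[]
  0∈span (d ∷ D) = subst (_∈ span (d ∷ D)) (identityˡ 0ᴳ) (∈-span∷⁺ 0<n (0∈span D))

  span⊆span∷ : ∀ d D → span D ⊆ span (d ∷ D)
  span⊆span∷ d D {s} s∈ = subst (_∈ span (d ∷ D)) (identityˡ s) (∈-span∷⁺ 0<n s∈)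

  ∈-span∷ : ∀ d D → d ∈ span (d ∷ D)
  ∈-span∷ d D with c , c<n , 1d≡cd ← mul-mod 1 d =
    subst (_∈ span (d ∷ D)) (trans (identityʳ _) (trans (sym 1d≡cd) (identityʳ d))) (∈-span∷⁺ c<n (0∈span D))

  span-+-closed : ∀ D x y → x ∈ span D → y ∈ span D → (x +ᴳ y) ∈ span D
  span-+-closed [] x y x∈ y∈ = subst (_∈ span [])
    (sym (trans (cong₂ _+ᴳ_ (∈-span[]⁻ x∈) (∈-span[]⁻ y∈)) (identityˡ 0ᴳ))) (0∈span [])
  span-+-closed (d ∷ D) x y x∈ y∈
    with c  , s  , s∈  , refl ← ∈-span∷⁻ x∈
    with c′ , s′ , s′∈ , refl ← ∈-span∷⁻ y∈
    with c″ , c″<n , [c+c′]d≡c″d ← mul-mod (c + c′) d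
    = subst (_∈ span (d ∷ D))
        (trans (cong (_+ᴳ (s +ᴳ s′)) (trans (sym [c+c′]d≡c″d) (mul-+ c c′ d)))
               (sym (interchange (mul G c d) s (mul G c′ d) s′)))
        (∈-span∷⁺ c″<n (span-+-closed D s s′ s∈ s′∈))

  span-isSubgroup : ∀ D → IsSubgroup G (span D)
  span-isSubgroup D = submonoid⇒subgroup (0∈span D , span-+-closed D)

  span⊆subgroup : ∀ {H} → IsSubgroup G H → ∀ D → All (_∈ H) D → span D ⊆ H
  span⊆subgroup {H} (0∈H , _ , _) [] _ y∈ = subst (_∈ H) (sym (∈-span[]⁻ y∈)) 0∈H
  span⊆subgroup H-subgroup@(0∈H , +-closed , _) (d ∷ D) (d∈H ∷ D⊆H) {y} y∈
    with c , s , s∈ , refl ← ∈-span∷⁻ y∈ =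
    +-closed _ _ (mul-closed (0∈H , +-closed) c d∈H) (span⊆subgroup H-subgroup D D⊆H s∈)

  coset-doubling : ∀ {K X h} → IsSubgroup G K → h ∉ K → K ⊆ X →
                   (∀ {k} → k ∈ K → (h +ᴳ k) ∈ X) → 2 * ∣ K ∣ ≤ ∣ X ∣
  coset-doubling {K} {X} {h} (_ , +-closed , -closed) h∉K K⊆X h+K⊆X = begin
    2 * ∣ K ∣                            ≡⟨ cong (∣ K ∣ +_) (+-identityʳ ∣ K ∣) ⟩
    ∣ K ∣ + ∣ K ∣                        ≡⟨ cong₂ _+_ (length-elements K) (trans (length-map (h +ᴳ_) ks) (length-elements K)) ⟨
    length ks + length (map (h +ᴳ_) ks)  ≡⟨ length-++ ks ⟨
    length (ks ++ map (h +ᴳ_) ks)        ≤⟨ Unique⇒length≤∣p∣ unique ⊆X ⟩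
    ∣ X ∣                                ∎
    where
    open ≤-Reasoning
    ks = elements K
    K∩h+K≡∅ : Disjoint ks (map (h +ᴳ_) ks)
    K∩h+K≡∅ (v∈ks , v∈h+ks) with k , k∈ks , refl ← ∈-map⁻ (h +ᴳ_) v∈h+ks =
      h∉K (subst (_∈ K) (//-rightDividesʳ k h) (+-closed _ _ (∈-elements⁻ v∈ks) (-closed k (∈-elements⁻ k∈ks))))
    unique : Unique (ks ++ map (h +ᴳ_) ks)
    unique = Unique.++⁺ (elements-unique K) (Unique.map⁺ (∙-cancelˡ h _ _) (elements-unique K)) K∩h+K≡∅
    ⊆X : ∀ {x} → x ∈ˡ ks ++ map (h +ᴳ_) ks → x ∈ X
    ⊆X x∈ with ∈-++⁻ ks x∈
    ... | inj₁ x∈ks = K⊆X (∈-elements⁻ x∈ks)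
    ... | inj₂ x∈h+ks with k , k∈ks , refl ← ∈-map⁻ (h +ᴳ_) x∈h+ks = h+K⊆X (∈-elements⁻ k∈ks)

  span-doubling : ∀ {h D} → h ∉ span D → 2 * ∣ span D ∣ ≤ ∣ span (h ∷ D) ∣
  span-doubling {h} {D} h∉ = coset-doubling (span-isSubgroup D) h∉ (span⊆span∷ h D)
    (λ k∈ → span-+-closed (h ∷ D) _ _ (∈-span∷ h D) (span⊆span∷ h D k∈))

  greedy-generators : ∀ {H} → IsSubgroup G H → ∀ j →
                      ∃[ D ] All (_∈ H) D × length D ≤ j × (H ⊆ span D ⊎ 2 ^ j ≤ ∣ span D ∣)
  greedy-generators H-subgroup zero = [] , [] , z≤n , inj₂ (≤-trans (s≤s z≤n) (x∈p⇒∣p-x∣<∣p∣ (0∈span [])))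
  greedy-generators {H} H-subgroup (suc j) with greedy-generators H-subgroup j
  ... | D , D⊆H , |D|≤j , inj₁ H⊆span = D , D⊆H , m≤n⇒m≤1+n |D|≤j , inj₁ H⊆span
  ... | D , D⊆H , |D|≤j , inj₂ 2^j≤∣span∣ with Fin.any? (λ h → h ∈? H ×-dec ¬? (h ∈? span D))
  ...   | yes (h , h∈H , h∉span) =
          h ∷ D , h∈H ∷ D⊆H , s≤s |D|≤j , inj₂ (≤-trans (*-monoʳ-≤ 2 2^j≤∣span∣) (span-doubling h∉span))
  ...   | no ∄h = D , D⊆H , m≤n⇒m≤1+n |D|≤j , inj₁ H⊆span
    where
    H⊆span : H ⊆ span D
    H⊆span {x} x∈H with x ∈? span D
    ... | yes x∈span = x∈span
    ... | no  x∉span = ⊥-elim (∄h (x , x∈H , x∉span))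

  ∃-large-span : ∀ {H L r} → IsSubgroup G H → L ≤ ∣ H ∣ → L ≤ 2 ^ r →
                 ∃[ D ] All (_∈ H) D × length D ≤ r × L ≤ ∣ span D ∣
  ∃-large-span {r = r} H-subgroup L≤∣H∣ L≤2^r with greedy-generators H-subgroup r
  ... | D , D⊆H , |D|≤r , inj₁ H⊆span    = D , D⊆H , |D|≤r , ≤-trans L≤∣H∣ (p⊆q⇒∣p∣≤∣q∣ H⊆span)
  ... | D , D⊆H , |D|≤r , inj₂ 2^r≤∣span∣ = D , D⊆H , |D|≤r , ≤-trans L≤2^r 2^r≤∣span∣

  opaque
    coset : Subset n → Fin n → Subset n
    coset K x = fromList (map (x +ᴳ_) (elements K))

    ∈-coset⁺ : ∀ {K x k} → k ∈ K → (x +ᴳ k) ∈ coset K x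
    ∈-coset⁺ {x = x} k∈K = ∈-fromList⁺ (∈-map⁺ (x +ᴳ_) (∈-elements⁺ k∈K))

    ∈-coset⁻ : ∀ {K x y} → y ∈ coset K x → ∃[ k ] k ∈ K × y ≡ x +ᴳ k
    ∈-coset⁻ {K} {x} y∈ with k , k∈ , refl ← ∈-map⁻ (x +ᴳ_) (∈-fromList⁻ (map (x +ᴳ_) (elements K)) y∈) =
      k , ∈-elements⁻ k∈ , refl

    ∣K∣≤∣coset∣ : ∀ K x → ∣ K ∣ ≤ ∣ coset K x ∣
    ∣K∣≤∣coset∣ K x = begin
      ∣ K ∣                              ≡⟨ length-elements K ⟨
      length (elements K)                ≡⟨ length-map (x +ᴳ_) (elements K) ⟨
      length (map (x +ᴳ_) (elements K))  ≤⟨ Unique⇒length≤∣fromList∣ (Unique.map⁺ (∙-cancelˡ x _ _) (elements-unique K)) ⟩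
      ∣ coset K x ∣                      ∎
      where open ≤-Reasoning

  coset-meet⇒⊆ : ∀ {K x y z} → IsSubgroup G K → z ∈ coset K x → z ∈ coset K y → coset K x ⊆ coset K y
  coset-meet⇒⊆ {K} {x} {y} (_ , +-closed , -closed) z∈x+K z∈y+K {w} w∈x+K
    with k₁ , k₁∈ , refl   ← ∈-coset⁻ z∈x+K
    with k₂ , k₂∈ , z≡y+k₂ ← ∈-coset⁻ z∈y+K
    with k  , k∈  , refl   ← ∈-coset⁻ w∈x+K
    = subst (_∈ coset K y) y+[k₂-k₁+k]≡x+k (∈-coset⁺ (+-closed _ _ k₂∈ (+-closed _ _ (-closed k₁ k₁∈) k∈)))
    where
    y+[k₂-k₁+k]≡x+k : y +ᴳ (k₂ +ᴳ ((-ᴳ k₁) +ᴳ k)) ≡ x +ᴳ k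
    y+[k₂-k₁+k]≡x+k = begin
      y +ᴳ (k₂ +ᴳ ((-ᴳ k₁) +ᴳ k))   ≡⟨ assoc y k₂ _ ⟨
      (y +ᴳ k₂) +ᴳ ((-ᴳ k₁) +ᴳ k)   ≡⟨ cong (_+ᴳ ((-ᴳ k₁) +ᴳ k)) z≡y+k₂ ⟨
      (x +ᴳ k₁) +ᴳ ((-ᴳ k₁) +ᴳ k)   ≡⟨ assoc x k₁ _ ⟩
      x +ᴳ (k₁ +ᴳ ((-ᴳ k₁) +ᴳ k))   ≡⟨ cong (x +ᴳ_) (\\-leftDividesˡ k₁ k) ⟩
      x +ᴳ k                        ∎
      where open ≡-Reasoning

  cosets : Subset n → List (Subset n)
  cosets K = deduplicate _≟ˢ_ (map (coset K) (allFin n))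

  ∈-cosets⁺ : ∀ K x → coset K x ∈ˡ cosets K
  ∈-cosets⁺ K x = ∈-deduplicate⁺ _≟ˢ_ (∈-map⁺ (coset K) (∈-allFin x))

  ∈-cosets⁻ : ∀ {K b} → b ∈ˡ cosets K → ∃[ x ] b ≡ coset K x
  ∈-cosets⁻ {K} b∈
    with x , _ , refl ← ∈-map⁻ (coset K) (∈-deduplicate⁻ _≟ˢ_ (map (coset K) (allFin n)) b∈) = x , refl

  cosets-count : ∀ {K L} → IsSubgroup G K → L ≤ ∣ K ∣ → length (cosets K) * L ≤ n
  cosets-count {K} {L} K-subgroup L≤∣K∣ = disjointBlocks-count (Deduplicate.deduplicate-! _≟ˢ_ _) meet large
    where
    meet : MeetOnlyIfEqual (cosets K)
    meet b∈ c∈ z∈b z∈c with x , refl ← ∈-cosets⁻ b∈ with y , refl ← ∈-cosets⁻ c∈ =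
      ⊆-antisym (coset-meet⇒⊆ K-subgroup z∈b z∈c) (coset-meet⇒⊆ K-subgroup z∈c z∈b)
    large : All (λ b → L ≤ ∣ b ∣) (cosets K)
    large = All.tabulate λ b∈ → let x , b≡x+K = ∈-cosets⁻ b∈ in
      subst (λ b → L ≤ ∣ b ∣) (sym b≡x+K) (≤-trans L≤∣K∣ (∣K∣≤∣coset∣ K x))

  cosets-cover-unionOfCosets : ∀ {A H K T} → IsSubgroup G H → 0ᴳ ∈ K → K ⊆ H →
                               (∀ y → (y ∈ A) ⇔ (∃[ t ] ∃[ h ] t ∈ T × h ∈ H × y ≡ t +ᴳ h)) →
                               Covers (cosets K) A
  cosets-cover-unionOfCosets {A} {H} {K} {T} (_ , +-closed , _) 0∈K K⊆H A≡T+H {y} y∈A =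
    coset K y , ∈-cosets⁺ K y , y+K⊆A , subst (_∈ coset K y) (identityʳ y) (∈-coset⁺ 0∈K)
    where
    y+K⊆A : coset K y ⊆ A
    y+K⊆A z∈y+K
      with k , k∈K , refl ← ∈-coset⁻ z∈y+K
      with t , h , t∈T , h∈H , refl ← Equivalence.to (A≡T+H y) y∈A
      = Equivalence.from (A≡T+H _) (t , h +ᴳ k , t∈T , +-closed h k h∈H (K⊆H k∈K) , assoc t h k)

  opaque
    grain : ℕ → Fin n → Fin n → Subset n
    grain L d s = fromList (applyUpTo (λ i → s +ᴳ mul G i d) L)

    ∈-grain⁺ : ∀ {L d s y} → InGrain G L d s y → y ∈ grain L d s
    ∈-grain⁺ {d = d} {s} (i , i<L , refl) = ∈-fromList⁺ (∈-applyUpTo⁺ (λ i → s +ᴳ mul G i d) i<L)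

    ∈-grain⁻ : ∀ {L d s y} → y ∈ grain L d s → InGrain G L d s y
    ∈-grain⁻ {L} {d} {s} y∈ = ∈-applyUpTo⁻ (λ i → s +ᴳ mul G i d) (∈-fromList⁻ (applyUpTo (λ i → s +ᴳ mul G i d) L) y∈)

    grain-size : ∀ {L d m} s → IsOrder G d m → L ≤ m → L ≤ ∣ grain L d s ∣
    grain-size {L} {d} s d-order L≤m = begin
      L                                          ≡⟨ length-applyUpTo (λ i → s +ᴳ mul G i d) L ⟨
      length (applyUpTo (λ i → s +ᴳ mul G i d) L) ≤⟨ Unique⇒length≤∣fromList∣ (Unique.applyUpTo⁺₁ _ L distinct) ⟩
      ∣ grain L d s ∣                            ∎
      where
      open ≤-Reasoning
      distinct : ∀ {i j} → i < j → j < L → s +ᴳ mul G i d ≢ s +ᴳ mul G j d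
      distinct i<j j<L si≡sj = <⇒≢ i<j (mul-injective d-order (<-≤-trans (<-trans i<j j<L) L≤m) (<-≤-trans j<L L≤m)
                                                          (∙-cancelˡ s _ _ si≡sj))

  -- Candidate families

  module _ {L : ℕ} (P : GrainPartition G L) where
    open GrainPartition P

    grains : Fin n → List (Subset n)
    grains d = deduplicate _≟ˢ_ (map (grain L d) (elements (S d)))

    ∈-grains⁻ : ∀ {d b} → b ∈ˡ grains d → ∃[ s ] s ∈ S d × b ≡ grain L d s
    ∈-grains⁻ {d} b∈
      with s , s∈ , refl ← ∈-map⁻ (grain L d) (∈-deduplicate⁻ _≟ˢ_ (map (grain L d) (elements (S d))) b∈) =
      s , ∈-elements⁻ s∈ , refl

    grains-count : ∀ {d m} → IsOrder G d m → L ≤ m → length (grains d) * L ≤ n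
    grains-count {d} {m} d-order L≤m = disjointBlocks-count (Deduplicate.deduplicate-! _≟ˢ_ _) meet large
      where
      meet : MeetOnlyIfEqual (grains d)
      meet b∈ c∈ z∈b z∈c
        with s , s∈ , refl ← ∈-grains⁻ b∈
        with s′ , s′∈ , refl ← ∈-grains⁻ c∈
        with i , i<L , z≡ ← ∈-grain⁻ z∈b
        with j , j<L , z≡′ ← ∈-grain⁻ z∈c
        = cong (grain L d) (disjoint d m d-order L≤m s s′ i j s∈ s′∈ i<L j<L (trans (sym z≡) z≡′))
      large : All (λ b → L ≤ ∣ b ∣) (grains d)
      large = All.tabulate λ b∈ → let s , _ , b≡grain = ∈-grains⁻ b∈ in
        subst (λ b → L ≤ ∣ b ∣) (sym b≡grain) (grain-size s d-order L≤m)

    progressionCandidates : Fin n → List (Subset n)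
    progressionCandidates d = unionsIfFew L (grains d)

    cosetCandidates : List (Fin n) → List (Subset n)
    cosetCandidates D = unionsIfFew L (cosets (span D))

    progressionGranular⇒∈candidates : ∀ {A} → ProgressionGranular G L P A →
                                      ∃[ d ] A ∈ˡ progressionCandidates d
    progressionGranular⇒∈candidates {A} (d , (m , d-order , L≤m) , T , T⊆S , A≡⋃grains) =
      d , ∈-unionsIfFew (grains-count d-order L≤m) cover
      where
      cover : Covers (grains d) A
      cover y∈A with s , s∈T , y∈grain ← Equivalence.to (A≡⋃grains _) y∈A =
        grain L d s , ∈-deduplicate⁺ _≟ˢ_ (∈-map⁺ (grain L d) (∈-elements⁺ (T⊆S s∈T))) ,
        (λ z∈ → Equivalence.from (A≡⋃grains _) (s , s∈T , ∈-grain⁻ z∈)) , ∈-grain⁺ y∈grain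

    cosetGranular⇒∈candidates : ∀ {A r} → L ≤ 2 ^ r → CosetGranular G L A →
                                ∃[ D ] length D ≤ r × A ∈ˡ cosetCandidates D
    cosetGranular⇒∈candidates L≤2^r (H , H-subgroup , L≤∣H∣ , T , A≡T+H)
      with D , D⊆H , |D|≤r , L≤∣span∣ ← ∃-large-span H-subgroup L≤∣H∣ L≤2^r =
      D , |D|≤r , ∈-unionsIfFew (cosets-count (span-isSubgroup D) L≤∣span∣)
                    (cosets-cover-unionOfCosets H-subgroup (0∈span D) (span⊆subgroup H-subgroup D D⊆H) A≡T+H)

    candidates : ℕ → List (Subset n)
    candidates r = concat (map progressionCandidates (allFin n)) ++ concat (map cosetCandidates (listsUpTo n r))

    granular⇒∈candidates : ∀ {A r} → L ≤ 2 ^ r → Granular G L P A → A ∈ˡ candidates r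
    granular⇒∈candidates {r = r} L≤2^r (inj₁ coset-granular)
      with D , |D|≤r , A∈ ← cosetGranular⇒∈candidates L≤2^r coset-granular =
      ∈-++⁺ʳ (concat (map progressionCandidates (allFin n)))
             (∈-concat⁺′ A∈ (∈-map⁺ cosetCandidates (∈-listsUpTo {k = r} D |D|≤r)))
    granular⇒∈candidates _ (inj₂ progression-granular)
      with d , A∈ ← progressionGranular⇒∈candidates progression-granular =
      ∈-++⁺ˡ (∈-concat⁺′ A∈ (∈-map⁺ progressionCandidates (∈-allFin d)))

    length-candidates : ∀ r .{{_ : NonZero L}} → length (candidates r) ≤ suc n ^ suc r * 2 ^ (n / L)
    length-candidates r = begin
      length (candidates r)
        ≡⟨ length-++ (concat (map progressionCandidates (allFin n))) ⟩
      length (concat (map progressionCandidates (allFin n))) + length (concat (map cosetCandidates (listsUpTo n r)))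
        ≤⟨ +-mono-≤ (length-concat-map≤ progressionCandidates (allFin n) (λ d → length-unionsIfFew L (grains d)))
                    (length-concat-map≤ cosetCandidates (listsUpTo n r) (λ D → length-unionsIfFew L (cosets (span D)))) ⟩
      length (allFin n) * 2 ^ (n / L) + length (listsUpTo n r) * 2 ^ (n / L)
        ≤⟨ +-mono-≤ (≤-reflexive (cong (_* 2 ^ (n / L)) (length-tabulate {n = n} (λ i → i))))
                    (*-monoˡ-≤ (2 ^ (n / L)) (length-listsUpTo n r)) ⟩
      n * 2 ^ (n / L) + suc n ^ r * 2 ^ (n / L)
        ≡⟨ *-distribʳ-+ (2 ^ (n / L)) n (suc n ^ r) ⟨
      (n + suc n ^ r) * 2 ^ (n / L)
        ≤⟨ *-monoˡ-≤ (2 ^ (n / L)) (≤-trans (≤-reflexive (+-comm n (suc n ^ r)))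
                                      (+-monoʳ-≤ (suc n ^ r) (m≤m*n n (suc n ^ r) {{m^n≢0 (suc n) r}}))) ⟩
      suc n ^ suc r * 2 ^ (n / L)
        ∎
      where open ≤-Reasoning

lemma3p3 : ∃[ n₀ ] ∀ (n : ℕ) (G : FinAbGroup n) → n₀ < n →
             ∀ (L : ℕ) → 1 ≤ L → L * L ≤ n →
             (P : GrainPartition G L) →
             (As : List (Subset n)) → Unique As → All (Granular G L P) As →
             length As ^ L ≤ 2 ^ (3 * n)
lemma3p3 = 2 ^ 16 , granular-families-bound
  where
  granular-families-bound : ∀ (n : ℕ) (G : FinAbGroup n) → 2 ^ 16 < n →
                            ∀ (L : ℕ) → 1 ≤ L → L * L ≤ n → (P : GrainPartition G L) →
                            (As : List (Subset n)) → Unique As → All (Granular G L P) As →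
                            length As ^ L ≤ 2 ^ (3 * n)
  granular-families-bound n G _      zero      () _    _ _  _   _
  granular-families-bound n G 2^16<n L@(suc L′) _  L²≤n P As As! granular
    with k , 2^k≤L , L<2^[1+k] ← log₂-bracket L′ = begin
      length As ^ L                            ≤⟨ ^-monoˡ-≤ L (Unique⇒length≤ As! As⊆candidates) ⟩
      length (candidates G P (suc k)) ^ L      ≤⟨ ^-monoˡ-≤ L (length-candidates G P (suc k)) ⟩
      (suc n ^ suc (suc k) * 2 ^ (n / L)) ^ L  ≤⟨ candidate-count-bound {n} {L} {suc k} 2^16<n L²≤n 2^[1+k]≤2L ⟩
      2 ^ (3 * n)                              ∎
    where
    open ≤-Reasoning
    As⊆candidates : ∀ {A} → A ∈ˡ As → A ∈ˡ candidates G P (suc k)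
    As⊆candidates A∈ = granular⇒∈candidates G P (<⇒≤ L<2^[1+k]) (All.lookup granular A∈)
    2^[1+k]≤2L : 2 ^ suc k ≤ 2 * L
    2^[1+k]≤2L = *-monoʳ-≤ 2 2^k≤L
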